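{- Let $(A,B)$ be a $(p,\rho_1,\rho_2)$-correlated pair of subsets of $I_n$, and set $\rho_3=(1-\rho_1)^2p^2+2(1-\rho_2)p(1-p)+(1-p)^2$ and $\rho_4=(1-\rho_1)p+(1-p)$. For every integer $k\in[0,2n]$, $$\mathbb{P}(k\notin A+B)=\begin{cases}\rho_3^{\min\{\frac{k+1}{2},\frac{2n-k+1}{2}\}}&\text{if }k\text{ is odd},\\ \rho_4\,\rho_3^{\min\{\frac{k}{2},\frac{2n-k}{2}\}}&\text{if }k\text{ is even}.\end{cases}$$
   Context: $I_n=\{0,1,\dots,n\}$. For $(p,\rho_1,\rho_2)\in[0,1]^3$, a $(p,\rho_1,\rho_2)$-correlated pair $(A,B)$ of subsets of $I_n$ is the random pair obtained by deciding independently for each $k\in I_n$: $k\in A$ with probability $p$; conditionally on $k\in A$, $k\in B$ with probability $\rho_1$; conditionally on $k\notin A$, $k\in B$ with probability $\rho_2$. $A+B=\{a+b:a\in A,b\in B\}$. -}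

module Defs where

open import Level using (_⊔_)
open import Algebra.Bundles using (CommutativeRing)
open import Data.Bool using (Bool; true; false; _∧_; _∨_; not)
open import Data.Nat using (ℕ; zero; suc; _≡ᵇ_) renaming (_+_ to _+ℕ_)
open import Data.Fin using (Fin; toℕ)
open import Data.List using (List; []; _∷_; _++_; map; foldr; allFin; concatMap)
open import Data.Vec using (Vec; []; _∷_; lookup)

-- A subset of I_n = {0,…,n} is a Bool-vector of length n+1
-- (entry i is true iff i belongs to the subset).
Subsetₙ : ℕ → Set
Subsetₙ n = Vec Bool (suc n)

allVecs : (m : ℕ) → List (Vec Bool m)
allVecs zero = [] ∷ []
allVecs (suc m) = map (true ∷_) (allVecs m) ++ map (false ∷_) (allVecs m)

anyL : ∀ {a} {X : Set a} → (X → Bool) → List X → Bool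
anyL f = foldr (λ x b → f x ∨ b) false

inSumset : ∀ {n} → ℕ → Subsetₙ n → Subsetₙ n → Bool
inSumset {n} k A B =
  anyL (λ i → anyL (λ j → lookup A i ∧ lookup B j ∧ ((toℕ i +ℕ toℕ j) ≡ᵇ k))
                   (allFin (suc n)))
       (allFin (suc n))

-- The probability model, with parameters p, ρ₁, ρ₂ in a commutative ring R
-- (the paper's setting is R = ℝ with p, ρ₁, ρ₂ ∈ [0,1]).
module Model {c ℓ} (R : CommutativeRing c ℓ) where
  open CommutativeRing R

  pow : Carrier → ℕ → Carrier
  pow x zero = 1#
  pow x (suc m) = x * pow x m

  sumL : List Carrier → Carrier
  sumL = foldr _+_ 0#

  -- P(k ∈ A, k ∈ B ∣ membership pattern) for one element k
  weight1 : (p ρ₁ ρ₂ : Carrier) → Bool → Bool → Carrier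
  weight1 p ρ₁ ρ₂ true  true  = p * ρ₁
  weight1 p ρ₁ ρ₂ true  false = p * (1# - ρ₁)
  weight1 p ρ₁ ρ₂ false true  = (1# - p) * ρ₂
  weight1 p ρ₁ ρ₂ false false = (1# - p) * (1# - ρ₂)

  pairProb : ∀ {m} (p ρ₁ ρ₂ : Carrier) → Vec Bool m → Vec Bool m → Carrier
  pairProb p ρ₁ ρ₂ [] [] = 1#
  pairProb p ρ₁ ρ₂ (a ∷ as) (b ∷ bs) = weight1 p ρ₁ ρ₂ a b * pairProb p ρ₁ ρ₂ as bs

  indicator : Bool → Carrier
  indicator true = 1#
  indicator false = 0#

  probNotInSumset : (n : ℕ) (p ρ₁ ρ₂ : Carrier) (k : ℕ) → Carrier
  probNotInSumset n p ρ₁ ρ₂ k =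
    sumL (concatMap (λ A → map (λ B → pairProb p ρ₁ ρ₂ A B * indicator (not (inSumset k A B)))
                              (allVecs (suc n)))
                    (allVecs (suc n)))

  ρ₃ : (p ρ₁ ρ₂ : Carrier) → Carrier
  ρ₃ p ρ₁ ρ₂ = (1# - ρ₁) * (1# - ρ₁) * p * p
             + (1# + 1#) * (1# - ρ₂) * p * (1# - p)
             + (1# - p) * (1# - p)

  ρ₄ : (p ρ₁ ρ₂ : Carrier) → Carrier
  ρ₄ p ρ₁ ρ₂ = (1# - ρ₁) * p + (1# - p)

module Submission where

-- Only the pairs (i, j) with i + j = k matter, and they involve a window of ℓ = min(k, 2n − k) + 1
-- consecutive positions: 0, …, k if k ≤ n, and k − n, …, n otherwise; the coordinates outside the window
-- average out. Inside the window the relevant pairs form the antidiagonal of an ℓ × ℓ grid. Peeling off the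
-- first and the last position, the two corner pairs are avoided with probability ρ₃, independently of the
-- antidiagonal of the inner (ℓ − 2)-window, and a window of length one is avoided with probability ρ₄.
-- Hence P(k ∉ A + B) = ρ₃^⌊ℓ/2⌋, times ρ₄ when ℓ is odd, i.e. when k is even.

open import Defs
open import Algebra.Bundles using (CommutativeRing)
open import Data.Bool using (Bool; true; false; _∧_; _∨_; not; T)
open import Data.Fin using (Fin; toℕ)
open import Data.List using (List; []; _∷_; allFin)
open import Data.Nat as ℕ using (ℕ; zero; suc)
open import Data.Empty using (⊥-elim)
open import Data.Product using (∃; ∃₂; _×_; _,_; proj₁; proj₂)
open import Data.Sum using (_⊎_; inj₁; inj₂)
open import Data.Vec using (Vec; []; _∷_; _∷ʳ_; lookup) renaming (_++_ to _++ᵛ_)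
open import Function.Bundles using (_⇔_; mk⇔; module Equivalence)
import Function.Properties.Equivalence as ⇔
open import Function.Base using (_∘′_)
open import Relation.Nullary using (¬_)
import Relation.Binary.PropositionalEquality as ≡

module Sumsets where
  open import Data.Nat using (_+_; _<_; _≤_; z≤n; s≤s; _≡ᵇ_)
  open import Data.Nat.Properties
  open import Data.Bool.Properties using (T-∧; T-∨)
  open import Data.Fin using (fromℕ<)
  open import Data.Fin.Properties using (toℕ-fromℕ<)
  open import Data.Bool.ListAction using (any)
  open import Data.List.Relation.Unary.Any.Properties using (any⁺; any⁻)
  open import Data.List.Membership.Propositional using (find; lose)
  open import Data.List.Membership.Propositional.Properties using (∈-allFin)
  open import Relation.Binary.PropositionalEquality
  open import Data.Nat.Solver using (module +-*-Solver)
  open +-*-Solver using (solve; _:=_; _:+_)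
  open Equivalence using (to; from)

  -- Positions past the end of the vector read as absent.
  at : ∀ {m} → Vec Bool m → ℕ → Bool
  at []      i       = false
  at (x ∷ A) zero    = x
  at (x ∷ A) (suc i) = at A i

  infix 4 _∈ᵛ_
  _∈ᵛ_ : ∀ {m} → ℕ → Vec Bool m → Set
  i ∈ᵛ A = T (at A i)

  ∈ᵛ⇒< : ∀ {m} (A : Vec Bool m) i → i ∈ᵛ A → i < m
  ∈ᵛ⇒< (x ∷ A) zero    _   = s≤s z≤n
  ∈ᵛ⇒< (x ∷ A) (suc i) i∈A = s≤s (∈ᵛ⇒< A i i∈A)

  at-toℕ : ∀ {m} (A : Vec Bool m) (i : Fin m) → at A (toℕ i) ≡ lookup A i
  at-toℕ (x ∷ A) Fin.zero    = refl
  at-toℕ (x ∷ A) (Fin.suc i) = at-toℕ A i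

  at-∷ʳ-< : ∀ {m} (A : Vec Bool m) y i → i < m → at (A ∷ʳ y) i ≡ at A i
  at-∷ʳ-< (x ∷ A) y zero    _         = refl
  at-∷ʳ-< (x ∷ A) y (suc i) (s≤s i<m) = at-∷ʳ-< A y i i<m

  at-∷ʳ-last : ∀ {m} (A : Vec Bool m) y → at (A ∷ʳ y) m ≡ y
  at-∷ʳ-last []      y = refl
  at-∷ʳ-last (x ∷ A) y = at-∷ʳ-last A y

  at-++-< : ∀ {d m} (A : Vec Bool d) (A′ : Vec Bool m) i → i < d → at (A ++ᵛ A′) i ≡ at A i
  at-++-< (x ∷ A) A′ zero    _         = refl
  at-++-< (x ∷ A) A′ (suc i) (s≤s i<d) = at-++-< A A′ i i<d

  at-++-+ : ∀ {d m} (A : Vec Bool d) (A′ : Vec Bool m) i → at (A ++ᵛ A′) (d + i) ≡ at A′ i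
  at-++-+ []      A′ i = refl
  at-++-+ (x ∷ A) A′ i = at-++-+ A A′ i

  InSumset : ∀ {m} → ℕ → Vec Bool m → Vec Bool m → Set
  InSumset k A B = ∃₂ λ i j → i + j ≡ k × i ∈ᵛ A × j ∈ᵛ B

  anyL≡any : ∀ {X : Set} (f : X → Bool) xs → anyL f xs ≡ any f xs
  anyL≡any f []       = refl
  anyL≡any f (x ∷ xs) = cong (f x ∨_) (anyL≡any f xs)

  T-anyL-allFin : ∀ {n} (f : Fin n → Bool) → T (anyL f (allFin n)) ⇔ ∃ λ i → T (f i)
  T-anyL-allFin {n} f = mk⇔
    (λ t → let i , _ , fi = find (any⁻ f (allFin n) (subst T (anyL≡any f (allFin n)) t)) in i , fi)
    (λ (i , fi) → subst T (sym (anyL≡any f (allFin n))) (any⁺ f (lose (∈-allFin i) fi)))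

  T-inSumset : ∀ {n} k (A B : Vec Bool (suc n)) → T (inSumset k A B) ⇔ InSumset k A B
  T-inSumset {n} k A B = mk⇔ to′ from′
    where
    to′ : T (inSumset k A B) → InSumset k A B
    to′ t with to (T-anyL-allFin _) t
    ... | i , t′ with to (T-anyL-allFin _) t′
    ... | j , t″ with to T-∧ t″
    ... | a , t‴ with to T-∧ t‴
    ... | b , eq =
      toℕ i , toℕ j , ≡ᵇ⇒≡ _ _ eq , subst T (sym (at-toℕ A i)) a , subst T (sym (at-toℕ B j)) b
    from′ : InSumset k A B → T (inSumset k A B)
    from′ (i , j , refl , i∈A , j∈B) =
      from (T-anyL-allFin _) (fromℕ< i<m , from (T-anyL-allFin _) (fromℕ< j<m ,
        from T-∧ (lookup-true A i<m i∈A , from T-∧ (lookup-true B j<m j∈B ,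
          subst₂ (λ x y → T (x + y ≡ᵇ i + j)) (sym (toℕ-fromℕ< i<m)) (sym (toℕ-fromℕ< j<m))
                 (≡⇒≡ᵇ (i + j) (i + j) refl)))))
      where
      i<m : i < suc n
      i<m = ∈ᵛ⇒< A i i∈A
      j<m : j < suc n
      j<m = ∈ᵛ⇒< B j j∈B
      lookup-true : ∀ {m} (C : Vec Bool m) {x} (x<m : x < m) → x ∈ᵛ C → T (lookup C (fromℕ< x<m))
      lookup-true C x<m x∈C = subst T (trans (cong (at C) (sym (toℕ-fromℕ< x<m))) (at-toℕ C _)) x∈C

  Antidiagonal : ∀ L → Vec Bool L → Vec Bool L → Set
  Antidiagonal L A B = ∃₂ λ s t → suc (s + t) ≡ L × s ∈ᵛ A × t ∈ᵛ B

  ¬antidiagonal-0 : ¬ Antidiagonal 0 [] []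
  ¬antidiagonal-0 (_ , _ , () , _)

  antidiagonal-1 : ∀ a b → Antidiagonal 1 (a ∷ []) (b ∷ []) ⇔ T (a ∧ b)
  antidiagonal-1 a b = mk⇔
    (λ { (zero , zero , _ , a∈ , b∈) → from T-∧ (a∈ , b∈) ; (zero , suc _ , () , _) ; (suc _ , _ , () , _) })
    (λ ab → zero , zero , refl , to T-∧ ab)

  -- xa, ya (xb, yb) are the first and last entries of A (of B); the corners are (0, L + 1) and (L + 1, 0).
  cornerHit : Bool → Bool → Bool → Bool → Bool
  cornerHit xa xb ya yb = (xa ∧ yb) ∨ (ya ∧ xb)

  antidiagonal-peel : ∀ L (A B : Vec Bool L) xa xb ya yb →
    Antidiagonal (suc (suc L)) (xa ∷ (A ∷ʳ ya)) (xb ∷ (B ∷ʳ yb)) ⇔ (T (cornerHit xa xb ya yb) ⊎ Antidiagonal L A B)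
  antidiagonal-peel L A B xa xb ya yb = mk⇔ to′ from′
    where
    corner₁ : T xa → T yb → T (cornerHit xa xb ya yb)
    corner₁ a b = from T-∨ (inj₁ (from T-∧ (a , b)))
    corner₂ : T ya → T xb → T (cornerHit xa xb ya yb)
    corner₂ a b = from T-∨ (inj₂ (from T-∧ (a , b)))
    inner : ∀ {s t} → suc (s + t) ≡ L → s < L × t < L
    inner {s} {t} refl = s≤s (m≤m+n s t) , s≤s (m≤n+m t s)
    to′ : Antidiagonal (suc (suc L)) (xa ∷ (A ∷ʳ ya)) (xb ∷ (B ∷ʳ yb)) → T (cornerHit xa xb ya yb) ⊎ Antidiagonal L A B
    to′ (zero , t , eq , a , b) rewrite suc-injective eq =
      inj₁ (corner₁ a (subst T (at-∷ʳ-last B yb) b))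
    to′ (suc s , zero , eq , a , b) rewrite +-identityʳ s | suc-injective (suc-injective eq) =
      inj₁ (corner₂ (subst T (at-∷ʳ-last A ya) a) b)
    to′ (suc s , suc t , eq , a , b) =
      let eq′ = trans (sym (+-suc s t)) (suc-injective (suc-injective eq))
          s<L , t<L = inner eq′
      in inj₂ (s , t , eq′ , subst T (at-∷ʳ-< A ya s s<L) a , subst T (at-∷ʳ-< B yb t t<L) b)
    from′ : T (cornerHit xa xb ya yb) ⊎ Antidiagonal L A B → Antidiagonal (suc (suc L)) (xa ∷ (A ∷ʳ ya)) (xb ∷ (B ∷ʳ yb))
    from′ (inj₁ c) with to T-∨ c
    ... | inj₁ ab = let a , b = to T-∧ ab in
      zero , suc L , refl , a , subst T (sym (at-∷ʳ-last B yb)) b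
    ... | inj₂ ab = let a , b = to T-∧ ab in
      suc L , zero , cong (suc ∘′ suc) (+-identityʳ L) , subst T (sym (at-∷ʳ-last A ya)) a , b
    from′ (inj₂ (s , t , eq , a , b)) =
      let s<L , t<L = inner eq in
      suc s , suc t , cong (suc ∘′ suc) (trans (+-suc s t) eq) ,
      subst T (sym (at-∷ʳ-< A ya s s<L)) a , subst T (sym (at-∷ʳ-< B yb t t<L)) b

  inSumset-prefix : ∀ {k d} (A B : Vec Bool (suc k)) (A′ B′ : Vec Bool d) →
    InSumset k (A ++ᵛ A′) (B ++ᵛ B′) ⇔ Antidiagonal (suc k) A B
  inSumset-prefix {k} A B A′ B′ = mk⇔ to′ from′
    where
    to′ : InSumset k (A ++ᵛ A′) (B ++ᵛ B′) → Antidiagonal (suc k) A B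
    to′ (i , j , refl , a , b) =
      i , j , refl ,
      subst T (at-++-< A A′ i (s≤s (m≤m+n i j))) a , subst T (at-++-< B B′ j (s≤s (m≤n+m j i))) b
    from′ : Antidiagonal (suc k) A B → InSumset k (A ++ᵛ A′) (B ++ᵛ B′)
    from′ (i , j , eq , a , b) with suc-injective eq
    ... | refl =
      i , j , refl ,
      subst T (sym (at-++-< A A′ i (s≤s (m≤m+n i j)))) a , subst T (sym (at-++-< B B′ j (s≤s (m≤n+m j i)))) b

  -- A summand below d would need a partner beyond the end of the vectors.
  inSumset-suffix : ∀ {d L} (A B : Vec Bool d) (A′ B′ : Vec Bool (suc L)) →
    InSumset (d + d + L) (A ++ᵛ A′) (B ++ᵛ B′) ⇔ Antidiagonal (suc L) A′ B′
  inSumset-suffix {d} {L} A B A′ B′ = mk⇔ to′ from′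
    where
    rearrange : ∀ s t → (d + s) + (d + t) ≡ d + d + (s + t)
    rearrange = solve 3 (λ d s t → (d :+ s) :+ (d :+ t) := d :+ d :+ (s :+ t)) refl d
    partner-in-range : ∀ i j → i + j ≡ d + d + L → j < d + suc L → d ≤ i
    partner-in-range i j eq j<end = +-cancelʳ-≤ (d + L) d i (begin
      d + (d + L) ≡⟨ +-assoc d d L ⟨
      d + d + L   ≡⟨ eq ⟨
      i + j       ≤⟨ +-monoʳ-≤ i (≤-pred (subst (j <_) (+-suc d L) j<end)) ⟩
      i + (d + L) ∎)
      where open ≤-Reasoning
    to′ : InSumset (d + d + L) (A ++ᵛ A′) (B ++ᵛ B′) → Antidiagonal (suc L) A′ B′
    to′ (i , j , eq , a , b)
      with m≤n⇒∃[o]m+o≡n (partner-in-range i j eq (∈ᵛ⇒< (B ++ᵛ B′) j b))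
         | m≤n⇒∃[o]m+o≡n (partner-in-range j i (trans (+-comm j i) eq) (∈ᵛ⇒< (A ++ᵛ A′) i a))
    ... | s , refl | t , refl =
      s , t , cong suc (+-cancelˡ-≡ (d + d) _ _ (trans (sym (rearrange s t)) eq)) ,
      subst T (at-++-+ A A′ s) a , subst T (at-++-+ B B′ t) b
    from′ : Antidiagonal (suc L) A′ B′ → InSumset (d + d + L) (A ++ᵛ A′) (B ++ᵛ B′)
    from′ (s , t , eq , a , b) =
      d + s , d + t , trans (rearrange s t) (cong (d + d +_) (suc-injective eq)) ,
      subst T (sym (at-++-+ A A′ s)) a , subst T (sym (at-++-+ B B′ t)) b

module Expectation {c ℓ} (R : CommutativeRing c ℓ) where
  open CommutativeRing R
  open Model R using (sumL; indicator)
  open import Data.List using (_++_; map; concatMap)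
  open import Data.List.Properties using (map-++; map-∘)
  open import Relation.Binary.Reasoning.Setoid setoid
  open import Algebra.Solver.Ring.NaturalCoefficients.Default commutativeSemiring
    using (solve; _:=_; _:+_; _:*_)

  x+[1-x]≈1 : ∀ x → x + (1# - x) ≈ 1#
  x+[1-x]≈1 x = begin
    x + (1# - x)   ≈⟨ +-congˡ (+-comm 1# (- x)) ⟩
    x + (- x + 1#) ≈⟨ +-assoc x (- x) 1# ⟨
    x - x + 1#     ≈⟨ +-congʳ (-‿inverseʳ x) ⟩
    0# + 1#        ≈⟨ +-identityˡ 1# ⟩
    1#             ∎

  Σ𝔹² : (Bool → Bool → Carrier) → Carrier
  Σ𝔹² h = (h true true + h true false) + (h false true + h false false)

  Σ𝔹²-cong : ∀ {h g} → (∀ a b → h a b ≈ g a b) → Σ𝔹² h ≈ Σ𝔹² g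
  Σ𝔹²-cong h≈g = +-cong (+-cong (h≈g true true) (h≈g true false)) (+-cong (h≈g false true) (h≈g false false))

  *-distribˡ-Σ𝔹² : ∀ x h → x * Σ𝔹² h ≈ Σ𝔹² (λ a b → x * h a b)
  *-distribˡ-Σ𝔹² x h =
    solve 5 (λ x a b c d → x :* ((a :+ b) :+ (c :+ d)) := (x :* a :+ x :* b) :+ (x :* c :+ x :* d)) refl
      x (h true true) (h true false) (h false true) (h false false)

  *-distribʳ-Σ𝔹² : ∀ x h → Σ𝔹² h * x ≈ Σ𝔹² (λ a b → h a b * x)
  *-distribʳ-Σ𝔹² x h =
    solve 5 (λ x a b c d → ((a :+ b) :+ (c :+ d)) :* x := (a :* x :+ b :* x) :+ (c :* x :+ d :* x)) refl
      x (h true true) (h true false) (h false true) (h false false)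

  Σ𝔹²-comm : ∀ (h : Bool → Bool → Bool → Bool → Carrier) →
    Σ𝔹² (λ a b → Σ𝔹² (λ c d → h a b c d)) ≈ Σ𝔹² (λ c d → Σ𝔹² (λ a b → h a b c d))
  Σ𝔹²-comm h = solve 16 (λ a₁ a₂ a₃ a₄ b₁ b₂ b₃ b₄ c₁ c₂ c₃ c₄ d₁ d₂ d₃ d₄ →
        ((a₁ :+ a₂) :+ (a₃ :+ a₄) :+ ((b₁ :+ b₂) :+ (b₃ :+ b₄)))
     :+ ((c₁ :+ c₂) :+ (c₃ :+ c₄) :+ ((d₁ :+ d₂) :+ (d₃ :+ d₄)))
     := ((a₁ :+ b₁) :+ (c₁ :+ d₁) :+ ((a₂ :+ b₂) :+ (c₂ :+ d₂)))
     :+ ((a₃ :+ b₃) :+ (c₃ :+ d₃) :+ ((a₄ :+ b₄) :+ (c₄ :+ d₄))))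
    refl
    (h true true true true) (h true true true false) (h true true false true) (h true true false false)
    (h true false true true) (h true false true false) (h true false false true) (h true false false false)
    (h false true true true) (h false true true false) (h false true false true) (h false true false false)
    (h false false true true) (h false false true false) (h false false false true) (h false false false false)

  IsIndicator¬ : ∀ {X Y : Set} → (X → Y → Set) → (X → Y → Carrier) → Set ℓ
  IsIndicator¬ P f = (∀ x y → P x y → f x y ≈ 0#) × (∀ x y → ¬ P x y → f x y ≈ 1#)

  isIndicator¬-⇔ : ∀ {X Y : Set} {P Q : X → Y → Set} {f} →
    (∀ x y → P x y ⇔ Q x y) → IsIndicator¬ P f → IsIndicator¬ Q f
  isIndicator¬-⇔ P⇔Q (on , off) =
    (λ x y q → on x y (Equivalence.from (P⇔Q x y) q)) ,
    (λ x y ¬q → off x y (λ p → ¬q (Equivalence.to (P⇔Q x y) p)))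

  isIndicator¬-∘ : ∀ {X Y X′ Y′ : Set} {P : X → Y → Set} {f} → IsIndicator¬ P f →
    (g : X′ → X) (h : Y′ → Y) → IsIndicator¬ (λ x y → P (g x) (h y)) (λ x y → f (g x) (h y))
  isIndicator¬-∘ (on , off) g h = (λ x y → on (g x) (h y)) , (λ x y → off (g x) (h y))

  indicator-not-isIndicator¬ : ∀ {X Y : Set} {P : X → Y → Set} (b : X → Y → Bool) →
    (∀ x y → T (b x y) ⇔ P x y) → IsIndicator¬ P (λ x y → indicator (not (b x y)))
  indicator-not-isIndicator¬ {P = P} b T⇔P = on , off
    where
    on : ∀ x y → P x y → indicator (not (b x y)) ≈ 0#
    on x y p with b x y | Equivalence.from (T⇔P x y)
    ... | true | _ = refl
    ... | false | from = ⊥-elim (from p)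
    off : ∀ x y → ¬ P x y → indicator (not (b x y)) ≈ 1#
    off x y ¬p with b x y | Equivalence.to (T⇔P x y)
    ... | true  | to = ⊥-elim (¬p (to _))
    ... | false | _  = refl

  isIndicator¬⇒≈indicator : ∀ {X Y : Set} {P : X → Y → Set} {f} x y (b : Bool) →
    IsIndicator¬ P f → P x y ⇔ T b → f x y ≈ indicator (not b)
  isIndicator¬⇒≈indicator x y true  (on , off) P⇔T = on x y (Equivalence.from P⇔T _)
  isIndicator¬⇒≈indicator x y false (on , off) P⇔T = off x y (Equivalence.to P⇔T)

  sumOver : ∀ {X : Set} → List X → (X → Carrier) → Carrier
  sumOver xs f = sumL (map f xs)

  sumOver-cong : ∀ {X : Set} (xs : List X) {f g} → (∀ x → f x ≈ g x) → sumOver xs f ≈ sumOver xs g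
  sumOver-cong []       f≈g = refl
  sumOver-cong (x ∷ xs) f≈g = +-cong (f≈g x) (sumOver-cong xs f≈g)

  sumL-++ : ∀ xs ys → sumL (xs ++ ys) ≈ sumL xs + sumL ys
  sumL-++ []       ys = sym (+-identityˡ _)
  sumL-++ (x ∷ xs) ys = trans (+-congˡ (sumL-++ xs ys)) (sym (+-assoc _ _ _))

  sumL-concatMap : ∀ {X : Set} (g : X → List Carrier) xs → sumL (concatMap g xs) ≈ sumOver xs (λ x → sumL (g x))
  sumL-concatMap g []       = refl
  sumL-concatMap g (x ∷ xs) = trans (sumL-++ (g x) (concatMap g xs)) (+-congˡ (sumL-concatMap g xs))

  sumOver-+ : ∀ {X : Set} (xs : List X) f g → sumOver xs (λ x → f x + g x) ≈ sumOver xs f + sumOver xs g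
  sumOver-+ []       f g = sym (+-identityʳ 0#)
  sumOver-+ (x ∷ xs) f g = trans (+-congˡ (sumOver-+ xs f g))
    (solve 4 (λ a b c d → (a :+ b) :+ (c :+ d) := (a :+ c) :+ (b :+ d)) refl (f x) (g x) (sumOver xs f) (sumOver xs g))

  *-distribˡ-sumOver : ∀ {X : Set} y (xs : List X) f → y * sumOver xs f ≈ sumOver xs (λ x → y * f x)
  *-distribˡ-sumOver y []       f = zeroʳ y
  *-distribˡ-sumOver y (x ∷ xs) f = trans (distribˡ y (f x) (sumOver xs f)) (+-congˡ (*-distribˡ-sumOver y xs f))

  sumOver-allVecs : ∀ m h →
    sumOver (allVecs (suc m)) h ≈ sumOver (allVecs m) (λ A → h (true ∷ A)) + sumOver (allVecs m) (λ A → h (false ∷ A))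
  sumOver-allVecs m h = begin
    sumL (map h (map (true ∷_) V ++ map (false ∷_) V))
      ≡⟨ ≡.cong sumL (map-++ h (map (true ∷_) V) (map (false ∷_) V)) ⟩
    sumL (map h (map (true ∷_) V) ++ map h (map (false ∷_) V))
      ≈⟨ sumL-++ (map h (map (true ∷_) V)) (map h (map (false ∷_) V)) ⟩
    sumL (map h (map (true ∷_) V)) + sumL (map h (map (false ∷_) V))
      ≡⟨ ≡.cong₂ (λ xs ys → sumL xs + sumL ys) (map-∘ V) (map-∘ V) ⟨
    sumOver V (λ A → h (true ∷ A)) + sumOver V (λ A → h (false ∷ A)) ∎
    where
    V : List (Vec Bool m)
    V = allVecs m

  sumOver²-allVecs : ∀ m (G : Vec Bool (suc m) → Vec Bool (suc m) → Carrier) →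
    sumOver (allVecs (suc m)) (λ A → sumOver (allVecs (suc m)) (G A))
      ≈ Σ𝔹² (λ a b → sumOver (allVecs m) (λ A → sumOver (allVecs m) (λ B → G (a ∷ A) (b ∷ B))))
  sumOver²-allVecs m G = begin
    sumOver V′ (λ A → sumOver V′ (G A))
      ≈⟨ sumOver-allVecs m (λ A → sumOver V′ (G A)) ⟩
    sumOver V (λ A → sumOver V′ (G (true ∷ A))) + sumOver V (λ A → sumOver V′ (G (false ∷ A)))
      ≈⟨ +-cong (sumOver-cong V (λ A → sumOver-allVecs m (G (true ∷ A))))
                (sumOver-cong V (λ A → sumOver-allVecs m (G (false ∷ A)))) ⟩
    sumOver V (λ A → GG true true A + GG true false A) + sumOver V (λ A → GG false true A + GG false false A)
      ≈⟨ +-cong (sumOver-+ V (GG true true) (GG true false)) (sumOver-+ V (GG false true) (GG false false)) ⟩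
    Σ𝔹² (λ a b → sumOver V (GG a b)) ∎
    where
    V : List (Vec Bool m)
    V = allVecs m
    V′ : List (Vec Bool (suc m))
    V′ = allVecs (suc m)
    GG : Bool → Bool → Vec Bool m → Carrier
    GG a b A = sumOver V (λ B → G (a ∷ A) (b ∷ B))

  module Weighted (w : Bool → Bool → Carrier) where

    𝔼 : (m : ℕ) → (Vec Bool m → Vec Bool m → Carrier) → Carrier
    𝔼 zero    F = F [] []
    𝔼 (suc m) F = Σ𝔹² (λ a b → w a b * 𝔼 m (λ A B → F (a ∷ A) (b ∷ B)))

    𝔼-cong : ∀ m {F G} → (∀ A B → F A B ≈ G A B) → 𝔼 m F ≈ 𝔼 m G
    𝔼-cong zero    F≈G = F≈G [] []
    𝔼-cong (suc m) F≈G = Σ𝔹²-cong (λ a b → *-congˡ {w a b} (𝔼-cong m (λ A B → F≈G (a ∷ A) (b ∷ B))))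

    𝔼-++ : ∀ d m F → 𝔼 (d ℕ.+ m) F ≈ 𝔼 d (λ A B → 𝔼 m (λ A′ B′ → F (A ++ᵛ A′) (B ++ᵛ B′)))
    𝔼-++ zero    m F = refl
    𝔼-++ (suc d) m F = Σ𝔹²-cong (λ a b → *-congˡ {w a b} (𝔼-++ d m (λ A B → F (a ∷ A) (b ∷ B))))

    𝔼-∷ʳ : ∀ m F → 𝔼 (suc m) F ≈ Σ𝔹² (λ a b → w a b * 𝔼 m (λ A B → F (A ∷ʳ a) (B ∷ʳ b)))
    𝔼-∷ʳ zero    F = refl
    𝔼-∷ʳ (suc m) F = begin
      Σ𝔹² (λ a b → w a b * 𝔼 (suc m) (λ A B → F (a ∷ A) (b ∷ B)))
        ≈⟨ Σ𝔹²-cong (λ a b → *-congˡ {w a b} (𝔼-∷ʳ m (λ A B → F (a ∷ A) (b ∷ B)))) ⟩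
      Σ𝔹² (λ a b → w a b * Σ𝔹² (λ c d → w c d * G a b c d))
        ≈⟨ Σ𝔹²-cong (λ a b → *-distribˡ-Σ𝔹² (w a b) (λ c d → w c d * G a b c d)) ⟩
      Σ𝔹² (λ a b → Σ𝔹² (λ c d → w a b * (w c d * G a b c d)))
        ≈⟨ Σ𝔹²-cong (λ a b → Σ𝔹²-cong (λ c d → x*[y*z]≈y*[x*z] (w a b) (w c d) (G a b c d))) ⟩
      Σ𝔹² (λ a b → Σ𝔹² (λ c d → w c d * (w a b * G a b c d)))
        ≈⟨ Σ𝔹²-comm (λ a b c d → w c d * (w a b * G a b c d)) ⟩
      Σ𝔹² (λ c d → Σ𝔹² (λ a b → w c d * (w a b * G a b c d)))
        ≈⟨ Σ𝔹²-cong (λ c d → *-distribˡ-Σ𝔹² (w c d) (λ a b → w a b * G a b c d)) ⟨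
      Σ𝔹² (λ c d → w c d * Σ𝔹² (λ a b → w a b * G a b c d)) ∎
      where
      G : Bool → Bool → Bool → Bool → Carrier
      G a b c d = 𝔼 m (λ A B → F (a ∷ (A ∷ʳ c)) (b ∷ (B ∷ʳ d)))
      x*[y*z]≈y*[x*z] : ∀ x y z → x * (y * z) ≈ y * (x * z)
      x*[y*z]≈y*[x*z] = solve 3 (λ x y z → x :* (y :* z) := y :* (x :* z)) refl

    module _ (w-total : Σ𝔹² w ≈ 1#) where

      𝔼-const : ∀ m x → 𝔼 m (λ _ _ → x) ≈ x
      𝔼-const zero    x = refl
      𝔼-const (suc m) x = begin
        Σ𝔹² (λ a b → w a b * 𝔼 m (λ _ _ → x)) ≈⟨ Σ𝔹²-cong (λ a b → *-congˡ {w a b} (𝔼-const m x)) ⟩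
        Σ𝔹² (λ a b → w a b * x)               ≈⟨ *-distribʳ-Σ𝔹² x w ⟨
        Σ𝔹² w * x                             ≈⟨ *-congʳ w-total ⟩
        1# * x                                ≈⟨ *-identityˡ x ⟩
        x                                     ∎

      𝔼-isIndicator¬ : ∀ {X Y : Set} {Q : X → Y → Set} d (f : X → Y → Vec Bool d → Vec Bool d → Carrier) →
        (∀ A B → IsIndicator¬ Q (λ x y → f x y A B)) → IsIndicator¬ Q (λ x y → 𝔼 d (f x y))
      𝔼-isIndicator¬ d f ind =
        (λ x y q → trans (𝔼-cong d (λ A B → proj₁ (ind A B) x y q)) (𝔼-const d 0#)) ,
        (λ x y ¬q → trans (𝔼-cong d (λ A B → proj₂ (ind A B) x y ¬q)) (𝔼-const d 1#))

module Correlated {c ℓ} (R : CommutativeRing c ℓ) (p ρ₁ ρ₂ : CommutativeRing.Carrier R) where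
  open CommutativeRing R
  open Model R
  open Expectation R
  open Sumsets
  open import Data.Nat.Properties using (+-suc)
  open import Relation.Binary.Reasoning.Setoid setoid
  open import Algebra.Solver.Ring.NaturalCoefficients.Default commutativeSemiring
    using (solve; _:=_; _:+_; _:*_; con; Polynomial)

  W : Bool → Bool → Carrier
  W = weight1 p ρ₁ ρ₂

  open Weighted W

  W-total : Σ𝔹² W ≈ 1#
  W-total = begin
    Σ𝔹² W
      ≈⟨ solve 6 (λ u r r̄ ū s s̄ → (u :* r :+ u :* r̄) :+ (ū :* s :+ ū :* s̄) := u :* (r :+ r̄) :+ ū :* (s :+ s̄))
               refl p ρ₁ (1# - ρ₁) (1# - p) ρ₂ (1# - ρ₂) ⟩
    p * (ρ₁ + (1# - ρ₁)) + (1# - p) * (ρ₂ + (1# - ρ₂)) ≈⟨ +-cong (*-congˡ (x+[1-x]≈1 ρ₁)) (*-congˡ (x+[1-x]≈1 ρ₂)) ⟩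
    p * 1# + (1# - p) * 1#                             ≈⟨ +-cong (*-identityʳ p) (*-identityʳ _) ⟩
    p + (1# - p)                                       ≈⟨ x+[1-x]≈1 p ⟩
    1#                                                 ∎

  sumOver-pairProb≈𝔼 : ∀ m F →
    sumOver (allVecs m) (λ A → sumOver (allVecs m) (λ B → pairProb p ρ₁ ρ₂ A B * F A B)) ≈ 𝔼 m F
  sumOver-pairProb≈𝔼 zero    F = trans (+-identityʳ _) (trans (+-identityʳ _) (*-identityˡ _))
  sumOver-pairProb≈𝔼 (suc m) F = begin
    sumOver V′ (λ A → sumOver V′ (λ B → pairProb p ρ₁ ρ₂ A B * F A B))
      ≈⟨ sumOver²-allVecs m (λ A B → pairProb p ρ₁ ρ₂ A B * F A B) ⟩
    Σ𝔹² (λ a b → sumOver V (λ A → sumOver V (λ B → (W a b * pairProb p ρ₁ ρ₂ A B) * F (a ∷ A) (b ∷ B))))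
      ≈⟨ Σ𝔹²-cong (λ a b → sumOver-cong V (λ A → sumOver-cong V (λ B →
           *-assoc (W a b) (pairProb p ρ₁ ρ₂ A B) (F (a ∷ A) (b ∷ B))))) ⟩
    Σ𝔹² (λ a b → sumOver V (λ A → sumOver V (λ B → W a b * G a b A B)))
      ≈⟨ Σ𝔹²-cong (λ a b → sumOver-cong V (λ A → *-distribˡ-sumOver (W a b) V (G a b A))) ⟨
    Σ𝔹² (λ a b → sumOver V (λ A → W a b * sumOver V (G a b A)))
      ≈⟨ Σ𝔹²-cong (λ a b → *-distribˡ-sumOver (W a b) V (λ A → sumOver V (G a b A))) ⟨
    Σ𝔹² (λ a b → W a b * sumOver V (λ A → sumOver V (G a b A)))
      ≈⟨ Σ𝔹²-cong (λ a b → *-congˡ {W a b} (sumOver-pairProb≈𝔼 m (λ A B → F (a ∷ A) (b ∷ B)))) ⟩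
    𝔼 (suc m) F ∎
    where
    V : List (Vec Bool m)
    V = allVecs m
    V′ : List (Vec Bool (suc m))
    V′ = allVecs (suc m)
    G : Bool → Bool → Vec Bool m → Vec Bool m → Carrier
    G a b A B = pairProb p ρ₁ ρ₂ A B * F (a ∷ A) (b ∷ B)

  probNotInSumset≈𝔼 : ∀ n k → probNotInSumset n p ρ₁ ρ₂ k ≈ 𝔼 (suc n) (λ A B → indicator (not (inSumset k A B)))
  probNotInSumset≈𝔼 n k = trans (sumL-concatMap _ (allVecs (suc n))) (sumOver-pairProb≈𝔼 (suc n) _)

  -- P(L - 1 ∉ A + B) for a correlated pair of length-L vectors, by 𝔼-antidiagonal below.
  missProb : ℕ → Carrier
  missProb zero          = 1#
  missProb (suc zero)    = ρ₄ p ρ₁ ρ₂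
  missProb (suc (suc L)) = ρ₃ p ρ₁ ρ₂ * missProb L

  -- Images of Σ𝔹², W and indicator among the solver's polynomials, so that it sees through the Boolean case split.
  module _ {n : ℕ} where
    Σ𝔹²ᵖ : (Bool → Bool → Polynomial n) → Polynomial n
    Σ𝔹²ᵖ h = (h true true :+ h true false) :+ (h false true :+ h false false)

    Wᵖ : (u r r̄ ū s s̄ : Polynomial n) → Bool → Bool → Polynomial n
    Wᵖ u r r̄ ū s s̄ true  true  = u :* r
    Wᵖ u r r̄ ū s s̄ true  false = u :* r̄
    Wᵖ u r r̄ ū s s̄ false true  = ū :* s
    Wᵖ u r r̄ ū s s̄ false false = ū :* s̄

    indicatorᵖ : Bool → Polynomial n
    indicatorᵖ true  = con 1
    indicatorᵖ false = con 0

  Σ𝔹²-W-not-both : Σ𝔹² (λ a b → W a b * indicator (not (a ∧ b))) ≈ ρ₄ p ρ₁ ρ₂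
  Σ𝔹²-W-not-both = begin
    Σ𝔹² (λ a b → W a b * indicator (not (a ∧ b)))
      ≈⟨ solve 6 (λ u r r̄ ū s s̄ → Σ𝔹²ᵖ (λ a b → Wᵖ u r r̄ ū s s̄ a b :* indicatorᵖ (not (a ∧ b)))
                                  := r̄ :* u :+ ū :* (s :+ s̄))
               refl p ρ₁ (1# - ρ₁) (1# - p) ρ₂ (1# - ρ₂) ⟩
    (1# - ρ₁) * p + (1# - p) * (ρ₂ + (1# - ρ₂)) ≈⟨ +-congˡ (trans (*-congˡ (x+[1-x]≈1 ρ₂)) (*-identityʳ _)) ⟩
    ρ₄ p ρ₁ ρ₂                                   ∎

  Σ𝔹²-W-no-corner : ∀ v →
    Σ𝔹² (λ a b → W a b * Σ𝔹² (λ c d → W c d * (indicator (not (cornerHit a b c d)) * v))) ≈ ρ₃ p ρ₁ ρ₂ * v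
  Σ𝔹²-W-no-corner v = begin
    Σ𝔹² (λ a b → W a b * Σ𝔹² (λ c d → W c d * (indicator (not (cornerHit a b c d)) * v)))
      ≈⟨ solve 7 (λ u r r̄ ū s s̄ v →
            Σ𝔹²ᵖ (λ a b → Wᵖ u r r̄ ū s s̄ a b :*
              Σ𝔹²ᵖ (λ c d → Wᵖ u r r̄ ū s s̄ c d :* (indicatorᵖ (not (cornerHit a b c d)) :* v)))
            := (r̄ :* r̄ :* u :* u :+ con 2 :* s̄ :* u :* ū :* (r :+ r̄) :+ ū :* ū :* ((s :+ s̄) :* (s :+ s̄))) :* v)
            refl p ρ₁ r̄ ū ρ₂ s̄ v ⟩
    (r̄ * r̄ * p * p + (1# + 1#) * s̄ * p * ū * (ρ₁ + r̄) + ū * ū * ((ρ₂ + s̄) * (ρ₂ + s̄))) * v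
      ≈⟨ *-congʳ (+-cong (+-congˡ (*-congˡ (x+[1-x]≈1 ρ₁))) (*-congˡ (*-cong (x+[1-x]≈1 ρ₂) (x+[1-x]≈1 ρ₂)))) ⟩
    (r̄ * r̄ * p * p + (1# + 1#) * s̄ * p * ū * 1# + ū * ū * (1# * 1#)) * v
      ≈⟨ solve 5 (λ r̄ u ū s̄ v →
            (r̄ :* r̄ :* u :* u :+ con 2 :* s̄ :* u :* ū :* con 1 :+ ū :* ū :* (con 1 :* con 1)) :* v
            := (r̄ :* r̄ :* u :* u :+ con 2 :* s̄ :* u :* ū :+ ū :* ū) :* v) refl r̄ p ū s̄ v ⟩
    ρ₃ p ρ₁ ρ₂ * v ∎
    where
    r̄ ū s̄ : Carrier
    r̄ = 1# - ρ₁
    ū = 1# - p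
    s̄ = 1# - ρ₂

  -- Peel off the first and the last position: the corners of the antidiagonal are hit independently
  -- of the inner (L - 2) × (L - 2) block, whose antidiagonal is the same problem again.
  𝔼-antidiagonal : ∀ L f → IsIndicator¬ (Antidiagonal L) f → 𝔼 L f ≈ missProb L
  𝔼-antidiagonal zero          f (_ , off) = off [] [] ¬antidiagonal-0
  𝔼-antidiagonal (suc zero)    f ind = begin
    Σ𝔹² (λ a b → W a b * f (a ∷ []) (b ∷ []))
      ≈⟨ Σ𝔹²-cong (λ a b → *-congˡ {W a b}
           (isIndicator¬⇒≈indicator (a ∷ []) (b ∷ []) (a ∧ b) ind (antidiagonal-1 a b))) ⟩
    Σ𝔹² (λ a b → W a b * indicator (not (a ∧ b))) ≈⟨ Σ𝔹²-W-not-both ⟩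
    ρ₄ p ρ₁ ρ₂                                    ∎
  𝔼-antidiagonal (suc (suc L)) f ind = begin
    Σ𝔹² (λ a b → W a b * 𝔼 (suc L) (λ A B → f (a ∷ A) (b ∷ B)))
      ≈⟨ Σ𝔹²-cong (λ a b → *-congˡ {W a b} (𝔼-∷ʳ L (λ A B → f (a ∷ A) (b ∷ B)))) ⟩
    Σ𝔹² (λ a b → W a b * Σ𝔹² (λ c d → W c d * 𝔼 L (inner a b c d)))
      ≈⟨ Σ𝔹²-cong (λ a b → *-congˡ {W a b} (Σ𝔹²-cong (λ c d → *-congˡ {W c d} (𝔼-inner a b c d)))) ⟩
    Σ𝔹² (λ a b → W a b * Σ𝔹² (λ c d → W c d * (indicator (not (cornerHit a b c d)) * missProb L)))
      ≈⟨ Σ𝔹²-W-no-corner (missProb L) ⟩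
    ρ₃ p ρ₁ ρ₂ * missProb L ∎
    where
    inner : Bool → Bool → Bool → Bool → Vec Bool L → Vec Bool L → Carrier
    inner a b c d A B = f (a ∷ (A ∷ʳ c)) (b ∷ (B ∷ʳ d))
    𝔼-inner : ∀ a b c d → 𝔼 L (inner a b c d) ≈ indicator (not (cornerHit a b c d)) * missProb L
    𝔼-inner a b c d with cornerHit a b c d | (λ A B → antidiagonal-peel L A B a b c d)
    ... | true  | peel = begin
      𝔼 L (inner a b c d)   ≈⟨ 𝔼-cong L (λ A B → proj₁ ind _ _ (Equivalence.from (peel A B) (inj₁ _))) ⟩
      𝔼 L (λ _ _ → 0#)      ≈⟨ 𝔼-const W-total L 0# ⟩
      0#                    ≈⟨ zeroˡ _ ⟨
      0# * missProb L       ∎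
    ... | false | peel = begin
      𝔼 L (inner a b c d)   ≈⟨ 𝔼-antidiagonal L _ (isIndicator¬-⇔ (λ A B → ⇔.trans (peel A B) ⊥⊎-⇔)
                                 (isIndicator¬-∘ ind (λ A → a ∷ (A ∷ʳ c)) (λ B → b ∷ (B ∷ʳ d)))) ⟩
      missProb L            ≈⟨ *-identityˡ _ ⟨
      1# * missProb L       ∎
      where
      ⊥⊎-⇔ : ∀ {X : Set} → (T false ⊎ X) ⇔ X
      ⊥⊎-⇔ = mk⇔ (λ { (inj₁ ()) ; (inj₂ x) → x }) inj₂

  inSumset-isIndicator¬ : ∀ {n} k → IsIndicator¬ (InSumset k) (λ (A B : Subsetₙ n) → indicator (not (inSumset k A B)))
  inSumset-isIndicator¬ k = indicator-not-isIndicator¬ (inSumset k) (T-inSumset k)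

  -- For k ≤ n only the positions 0, …, k can contribute to the sum k.
  probNotInSumset-prefix : ∀ k e → probNotInSumset (k ℕ.+ e) p ρ₁ ρ₂ k ≈ missProb (suc k)
  probNotInSumset-prefix k e = begin
    probNotInSumset (k ℕ.+ e) p ρ₁ ρ₂ k
      ≈⟨ probNotInSumset≈𝔼 (k ℕ.+ e) k ⟩
    𝔼 (suc k ℕ.+ e) f
      ≈⟨ 𝔼-++ (suc k) e f ⟩
    𝔼 (suc k) (λ A B → 𝔼 e (λ A′ B′ → f (A ++ᵛ A′) (B ++ᵛ B′)))
      ≈⟨ 𝔼-antidiagonal (suc k) _ (𝔼-isIndicator¬ W-total e _ (λ A′ B′ →
           isIndicator¬-⇔ (λ A B → inSumset-prefix A B A′ B′)
             (isIndicator¬-∘ (inSumset-isIndicator¬ k) (_++ᵛ A′) (_++ᵛ B′)))) ⟩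
    missProb (suc k) ∎
    where
    f : Subsetₙ (k ℕ.+ e) → Subsetₙ (k ℕ.+ e) → Carrier
    f A B = indicator (not (inSumset k A B))

  -- For k = 2d + L ≥ n = d + L only the positions d, …, n can contribute to the sum k.
  probNotInSumset-suffix : ∀ d L → probNotInSumset (d ℕ.+ L) p ρ₁ ρ₂ (d ℕ.+ d ℕ.+ L) ≈ missProb (suc L)
  probNotInSumset-suffix d L =
    trans (probNotInSumset≈𝔼 (d ℕ.+ L) k) (𝔼-suffix (≡.sym (+-suc d L)) f (inSumset-isIndicator¬ k))
    where
    k : ℕ
    k = d ℕ.+ d ℕ.+ L
    f : Subsetₙ (d ℕ.+ L) → Subsetₙ (d ℕ.+ L) → Carrier
    f A B = indicator (not (inSumset k A B))
    𝔼-suffix : ∀ {M} → M ≡.≡ d ℕ.+ suc L → (g : Vec Bool M → Vec Bool M → Carrier) →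
               IsIndicator¬ (InSumset k) g → 𝔼 M g ≈ missProb (suc L)
    𝔼-suffix ≡.refl g ind = begin
      𝔼 (d ℕ.+ suc L) g
        ≈⟨ 𝔼-++ d (suc L) g ⟩
      𝔼 d (λ A B → 𝔼 (suc L) (λ A′ B′ → g (A ++ᵛ A′) (B ++ᵛ B′)))
        ≈⟨ 𝔼-cong d (λ A B → 𝔼-antidiagonal (suc L) _
             (isIndicator¬-⇔ (λ A′ B′ → inSumset-suffix A B A′ B′) (isIndicator¬-∘ ind (A ++ᵛ_) (B ++ᵛ_)))) ⟩
      𝔼 d (λ _ _ → missProb (suc L))
        ≈⟨ 𝔼-const W-total d _ ⟩
      missProb (suc L) ∎

open import Data.Nat using (_+_; _*_; _∸_; _⊓_; _≤_; _≤?_)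
open import Data.Nat.Properties
  using (m≤n⇒∃[o]m+o≡n; +-cancelˡ-≤; +-comm; +-∸-assoc; *-suc; *-distribˡ-∸; *-distribˡ-⊓; m≤m+n; m≤n+m; ≰⇒≥;
         m+n≤o⇒m≤o∸n; m+n∸m≡n; m≤n⇒m⊓n≡m; m≥n⇒m⊓n≡n; +-identityʳ)
open import Data.Nat.Solver using (module +-*-Solver)
open import Relation.Nullary using (yes; no)
open import Relation.Binary.PropositionalEquality using (_≡_; refl; cong; cong₂; sym; trans; subst; module ≡-Reasoning)
open +-*-Solver using (solve; _:=_; _:+_; _:*_; con)

suffix-shape : ∀ {n k} → n ≤ k → k ≤ 2 * n → ∃₂ λ d L → n ≡ d + L × k ≡ d + d + L
suffix-shape {n} {k} n≤k k≤2n with m≤n⇒∃[o]m+o≡n n≤k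
... | d , refl with m≤n⇒∃[o]m+o≡n (+-cancelˡ-≤ n d n (subst (n + d ≤_) (cong (n +_) (+-identityʳ n)) k≤2n))
... | L , refl = d , L , refl , solve 2 (λ d L → d :+ L :+ d := d :+ d :+ L) refl d L

odd-window : ∀ m n → 2 * m + 1 ≤ 2 * n → suc ((2 * m + 1) ⊓ (2 * n ∸ (2 * m + 1))) ≡ 2 * ((m + 1) ⊓ (n ∸ m))
odd-window m n h = begin
  suc (2 * m + 1) ⊓ suc (2 * n ∸ (2 * m + 1))
    ≡⟨ cong₂ _⊓_ (solve 1 (λ m → con 1 :+ (con 2 :* m :+ con 1) := con 2 :* (m :+ con 1)) refl m) suc-∸ ⟩
  2 * (m + 1) ⊓ (2 * n ∸ 2 * m)
    ≡⟨ cong (2 * (m + 1) ⊓_) (*-distribˡ-∸ 2 n m) ⟨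
  2 * (m + 1) ⊓ (2 * (n ∸ m))
    ≡⟨ *-distribˡ-⊓ 2 (m + 1) (n ∸ m) ⟨
  2 * ((m + 1) ⊓ (n ∸ m)) ∎
  where
  open ≡-Reasoning
  suc-∸ : suc (2 * n ∸ (2 * m + 1)) ≡ 2 * n ∸ 2 * m
  suc-∸ rewrite +-comm (2 * m) 1 = sym (+-∸-assoc 1 h)

even-window : ∀ m n → 2 * m ⊓ (2 * n ∸ 2 * m) ≡ 2 * (m ⊓ (n ∸ m))
even-window m n = trans (cong (2 * m ⊓_) (sym (*-distribˡ-∸ 2 n m))) (sym (*-distribˡ-⊓ 2 m (n ∸ m)))

module _ {c ℓ} (R : CommutativeRing c ℓ) (p ρ₁ ρ₂ : CommutativeRing.Carrier R) where
  open CommutativeRing R using (_≈_; reflexive; *-congˡ; *-congʳ; *-assoc; *-comm; *-identityʳ)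
    renaming (_*_ to _·_; trans to ≈-trans; sym to ≈-sym)
  open Model R using (pow; ρ₃; ρ₄; probNotInSumset)
  open Correlated R p ρ₁ ρ₂ using (missProb; probNotInSumset-prefix; probNotInSumset-suffix)

  missProb-even : ∀ t → missProb (2 * t) ≈ pow (ρ₃ p ρ₁ ρ₂) t
  missProb-even zero    = reflexive refl
  missProb-even (suc t) = ≈-trans (reflexive (cong missProb (*-suc 2 t))) (*-congˡ (missProb-even t))

  missProb-odd : ∀ t → missProb (suc (2 * t)) ≈ ρ₄ p ρ₁ ρ₂ · pow (ρ₃ p ρ₁ ρ₂) t
  missProb-odd zero    = ≈-sym (*-identityʳ _)
  missProb-odd (suc t) = ≈-trans (reflexive (cong (missProb ∘′ suc) (*-suc 2 t)))
    (≈-trans (*-congˡ (missProb-odd t))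
    (≈-trans (≈-sym (*-assoc _ _ _)) (≈-trans (*-congʳ (*-comm _ _)) (*-assoc _ _ _))))

  probNotInSumset≈missProb : ∀ n k → k ≤ 2 * n → probNotInSumset n p ρ₁ ρ₂ k ≈ missProb (suc (k ⊓ (2 * n ∸ k)))
  probNotInSumset≈missProb n k k≤2n with k ≤? n
  ... | yes k≤n with m≤n⇒∃[o]m+o≡n k≤n
  ...   | e , refl = ≈-trans (probNotInSumset-prefix k e) (reflexive (cong (missProb ∘′ suc) (sym ⊓-prefix)))
    where
    ⊓-prefix : k ⊓ (2 * (k + e) ∸ k) ≡ k
    ⊓-prefix = m≤n⇒m⊓n≡m (m+n≤o⇒m≤o∸n k (subst (k + k ≤_)
      (solve 2 (λ k e → k :+ k :+ con 2 :* e := con 2 :* (k :+ e)) refl k e) (m≤m+n (k + k) (2 * e))))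
  probNotInSumset≈missProb n k k≤2n | no k≰n with suffix-shape (≰⇒≥ k≰n) k≤2n
  ... | d , L , refl , refl = ≈-trans (probNotInSumset-suffix d L) (reflexive (cong (missProb ∘′ suc) (sym ⊓-suffix)))
    where
    ⊓-suffix : (d + d + L) ⊓ (2 * (d + L) ∸ (d + d + L)) ≡ L
    ⊓-suffix = trans
      (cong (λ x → (d + d + L) ⊓ (x ∸ (d + d + L)))
            (solve 2 (λ d L → con 2 :* (d :+ L) := d :+ d :+ L :+ L) refl d L))
      (trans (cong ((d + d + L) ⊓_) (m+n∸m≡n (d + d + L) L)) (m≥n⇒m⊓n≡n (m≤n+m L (d + d))))

lemma2p2 : ∀ {c ℓ} (R : CommutativeRing c ℓ) →
    let open CommutativeRing R using (_≈_) renaming (_*_ to _·_)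
        open Model R
    in ∀ (n : ℕ) (p ρ₁ ρ₂ : CommutativeRing.Carrier R) →
       (∀ (m : ℕ) → 2 * m + 1 ≤ 2 * n →
          probNotInSumset n p ρ₁ ρ₂ (2 * m + 1) ≈ pow (ρ₃ p ρ₁ ρ₂) ((m + 1) ⊓ (n ∸ m)))
       × (∀ (m : ℕ) → 2 * m ≤ 2 * n →
          probNotInSumset n p ρ₁ ρ₂ (2 * m) ≈ ρ₄ p ρ₁ ρ₂ · pow (ρ₃ p ρ₁ ρ₂) (m ⊓ (n ∸ m)))
lemma2p2 R n p ρ₁ ρ₂ = odd , even
  where
  open CommutativeRing R using (_≈_; reflexive) renaming (_*_ to _·_; trans to ≈-trans)
  open Model R using (pow; ρ₃; ρ₄; probNotInSumset)
  open Correlated R p ρ₁ ρ₂ using (missProb)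
  odd : ∀ m → 2 * m + 1 ≤ 2 * n → probNotInSumset n p ρ₁ ρ₂ (2 * m + 1) ≈ pow (ρ₃ p ρ₁ ρ₂) ((m + 1) ⊓ (n ∸ m))
  odd m h = ≈-trans (probNotInSumset≈missProb R p ρ₁ ρ₂ n (2 * m + 1) h)
    (≈-trans (reflexive (cong missProb (odd-window m n h))) (missProb-even R p ρ₁ ρ₂ ((m + 1) ⊓ (n ∸ m))))
  even : ∀ m → 2 * m ≤ 2 * n → probNotInSumset n p ρ₁ ρ₂ (2 * m) ≈ ρ₄ p ρ₁ ρ₂ · pow (ρ₃ p ρ₁ ρ₂) (m ⊓ (n ∸ m))
  even m h = ≈-trans (probNotInSumset≈missProb R p ρ₁ ρ₂ n (2 * m) h)
    (≈-trans (reflexive (cong (missProb ∘′ suc) (even-window m n))) (missProb-odd R p ρ₁ ρ₂ (m ⊓ (n ∸ m))))
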